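{- Consider the following goldbug system. Every positive integer $i\ge 1$ carries an arrow which is either Inbound or Outbound, all initially Outbound; the integers $0$ and $-1$ are cups. Bugs are released one at a time at site $1$. A bug at site $i\ge1$ first flips the arrow at $i$ and then hops to $i-2$ if the arrow now points Inbound, and to $i+1$ if it now points Outbound; a bug reaching $0$ or $-1$ stops there, and then the next bug is released. (Every bug lands in a cup.) Let $\phi=(1+\sqrt5)/2$. For $n\ge1$ let $a_n$ and $b_n$ be the numbers of the first $n$ bugs that land in the cup at $-1$ and at $0$ respectively. Then $-1< b_n-a_n/\phi< 1/\phi$ for all $n$; consequently, whenever $a_n>0$, $\left|\frac{b_n}{a_n}-\frac1\phi\right|<\frac1{a_n}$, and $a_n/n\to 1/\phi$ as $n\to\infty$. -}

module Defs where

open import Data.Bool using (Bool; true; false; not)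
open import Data.Nat as ℕ using (ℕ; zero; suc; _≡ᵇ_)
open import Data.Integer as ℤ using (ℤ; +_; -[1+_])
open import Data.Rational as ℚ using (ℚ; 0ℚ; 1ℚ)
open import Data.Product using (_×_)
open import Data.Sum using (_⊎_)
open import Relation.Binary.PropositionalEquality using (_≡_)

-- Arrow configuration: the arrow at site i (i ≥ 1) is Inbound iff the
-- value is true; the value at index 0 is irrelevant (0 is a cup).
Arrows : Set
Arrows = ℕ → Bool

initial : Arrows
initial _ = false

flipAt : Arrows → ℕ → Arrows
flipAt c i j with i ≡ᵇ j
... | true  = not (c j)
... | false = c j

data Cup : Set where
  cup0    : Cup
  cupNeg1 : Cup

data Walk : Arrows → ℤ → Cup → Arrows → Set where
  stop0    : ∀ {c} → Walk c (+ 0) cup0 c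
  stopNeg1 : ∀ {c} → Walk c -[1+ 0 ] cupNeg1 c
  -- arrow at site (suc k) was Outbound, after flipping it is Inbound: hop to i - 2
  hopIn    : ∀ {c k r c'} → c (suc k) ≡ false →
             Walk (flipAt c (suc k)) (+ suc k ℤ.- + 2) r c' →
             Walk c (+ suc k) r c'
  -- arrow at site (suc k) was Inbound, after flipping it is Outbound: hop to i + 1
  hopOut   : ∀ {c k r c'} → c (suc k) ≡ true →
             Walk (flipAt c (suc k)) (+ suc (suc k)) r c' →
             Walk c (+ suc k) r c'

-- Run n a b c : after the first n bugs (each released at site 1 after the
-- previous one stopped), a of them landed in the cup at -1, b of them in
-- the cup at 0, and the arrow configuration is c.
data Run : ℕ → ℕ → ℕ → Arrows → Set where
  start   : Run 0 0 0 initial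
  landNeg1 : ∀ {n a b c c'} → Run n a b c → Walk c (+ 1) cupNeg1 c' →
             Run (suc n) (suc a) b c'
  land0   : ∀ {n a b c c'} → Run n a b c → Walk c (+ 1) cup0 c' →
             Run (suc n) a (suc b) c'

-- Exact arithmetic in ℚ(φ), φ = (1 + √5)/2.
-- An element p + q·φ with p q rational.

record ℚφ : Set where
  constructor _+_φ
  field
    rat : ℚ
    irr : ℚ
open ℚφ public

infixl 6 _⊕_ _⊖_

_⊕_ : ℚφ → ℚφ → ℚφ
(p + q φ) ⊕ (p' + q' φ) = (p ℚ.+ p') + (q ℚ.+ q') φ

⊖_ : ℚφ → ℚφ
⊖ (p + q φ) = (ℚ.- p) + (ℚ.- q) φ

_⊖_ : ℚφ → ℚφ → ℚφ
x ⊖ y = x ⊕ (⊖ y)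

[_] : ℚ → ℚφ
[ r ] = r + 0ℚ φ

_·_ : ℚ → ℚφ → ℚφ
r · (p + q φ) = (r ℚ.* p) + (r ℚ.* q) φ

φ : ℚφ
φ = 0ℚ + 1ℚ φ

-- 1/φ = φ - 1 (since φ² = φ + 1)
φ⁻¹ : ℚφ
φ⁻¹ = (ℚ.- 1ℚ) + 1ℚ φ

-- Positivity of the real number p + qφ = (u + v√5)/2 with u = 2p+q, v = q,
-- obtained by the usual case analysis on signs and comparing squares.
Positive : ℚφ → Set
Positive (p + q φ) =
    (0ℚ ℚ.≤ u × 0ℚ ℚ.≤ v × (0ℚ ℚ.< u ⊎ 0ℚ ℚ.< v))
  ⊎ (0ℚ ℚ.< u × v ℚ.< 0ℚ × five ℚ.* (v ℚ.* v) ℚ.< u ℚ.* u)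
  ⊎ (u ℚ.< 0ℚ × 0ℚ ℚ.< v × u ℚ.* u ℚ.< five ℚ.* (v ℚ.* v))
  where
    u = (p ℚ.+ p) ℚ.+ q
    v = q
    five = + 5 ℚ./ 1

infix 4 _<φ_
_<φ_ : ℚφ → ℚφ → Set
x <φ y = Positive (y ⊖ x)

ℕ→ℚ : ℕ → ℚ
ℕ→ℚ n = + n ℚ./ 1

-- Weight an Inbound arrow at site i by ψ ^ (i - 1) and a bug at position p by ψ ^ p,
-- where ψ = 1 - φ = -1/φ is the other root of x² = x + 1. A hop of a bug flips one arrow
-- and moves the bug so that ψ ^ (i + 1) = ψ ^ (i - 1) + ψ ^ i keeps the total weight
-- unchanged; hence a bug landing at -1 (weight ψ⁻¹ = -φ) raises the arrow weight by 1 and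
-- one landing at 0 by -φ, and after a + b bugs the arrows weigh a - bφ. A finite sum of
-- distinct powers of ψ lies strictly between ψ + ψ³ + … = -1 and 1 + ψ² + … = φ, and
-- multiplying -1 < a - bφ < φ by ψ gives -1 < b - a/φ < 1/φ; dividing by a, or using
-- a + b = n, gives the other two estimates. Positivity of x ∈ ℚ(φ) is certified by
-- nonnegative rational coordinates of x φ ^ k for some k. Every bug lands because only
-- finitely many arrows are ever Inbound: a bug climbs through Inbound arrows to the first
-- Outbound one and then falls back two sites per hop across Outbound arrows.

module Submission where

open import Defs
open import Level using (0ℓ)
open import Function using (_∘_; id)
open import Data.Bool using (Bool; true; false; not)
open import Data.Empty using (⊥-elim)
open import Data.Maybe using (Maybe; just; nothing)
open import Data.Product using (_×_; _,_; ∃-syntax; map; map₂)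
import Data.Sum as Sum
open import Data.Sum using (_⊎_; inj₁; inj₂)
open import Data.Nat as ℕ using (ℕ; zero; suc; _≤_; _<_; z≤n; s≤s; _⊔_)
import Data.Nat.Properties as ℕ
open import Data.Integer as ℤ using (ℤ; +_; -[1+_])
import Data.Integer.Properties as ℤ
import Data.Integer.Tactic.RingSolver as ℤ-Solver
open import Data.Rational as ℚ using (ℚ; 0ℚ; 1ℚ)
import Data.Rational.Properties as ℚ
open import Data.Rational.Solver using (module +-*-Solver)
open import Data.Rational.Unnormalised as ℚᵘ using (mkℚᵘ; *≡*)
import Data.Rational.Unnormalised.Properties as ℚᵘ
open import Relation.Binary.PropositionalEquality hiding ([_])
open import Relation.Binary.Definitions using (tri<; tri≈; tri>)
open import Relation.Nullary using (Dec; yes; no)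
open import Relation.Nullary.Decidable using (_×-dec_; _⊎-dec_; from-yes; True; toWitness)
open import Algebra.Bundles using (CommutativeRing; Semiring)
open import Algebra.Structures {A = ℚφ} _≡_ using (IsCommutativeRing)
open import Algebra.Consequences.Propositional using (comm∧distrˡ⇒distrʳ; comm∧idˡ⇒idʳ)
open import Tactic.RingSolver using (solve-∀)
import Tactic.RingSolver.Core.AlmostCommutativeRing as ACR

0≤+ : ∀ {p q} → 0ℚ ℚ.≤ p → 0ℚ ℚ.≤ q → 0ℚ ℚ.≤ p ℚ.+ q
0≤+ = ℚ.+-mono-≤

0<+ˡ : ∀ {p q} → 0ℚ ℚ.< p → 0ℚ ℚ.≤ q → 0ℚ ℚ.< p ℚ.+ q
0<+ˡ = ℚ.+-mono-<-≤

0<+ʳ : ∀ {p q} → 0ℚ ℚ.≤ p → 0ℚ ℚ.< q → 0ℚ ℚ.< p ℚ.+ q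
0<+ʳ = ℚ.+-mono-≤-<

0≤* : ∀ {p q} → 0ℚ ℚ.≤ p → 0ℚ ℚ.≤ q → 0ℚ ℚ.≤ p ℚ.* q
0≤* {p} {q} 0≤p 0≤q =
  ℚ.nonNegative⁻¹ _ {{ℚ.nonNeg*nonNeg⇒nonNeg p {{ℚ.nonNegative 0≤p}} q {{ℚ.nonNegative 0≤q}}}}

0<* : ∀ {p q} → 0ℚ ℚ.< p → 0ℚ ℚ.< q → 0ℚ ℚ.< p ℚ.* q
0<* {p} {q} 0<p 0<q =
  ℚ.positive⁻¹ _ {{ℚ.pos*pos⇒pos p {{ℚ.positive 0<p}} q {{ℚ.positive 0<q}}}}

<⇒0<- : ∀ {p q} → p ℚ.< q → 0ℚ ℚ.< q ℚ.- p
<⇒0<- {p} {q} p<q = subst (ℚ._< q ℚ.- p) (ℚ.+-inverseʳ p) (ℚ.+-monoˡ-< (ℚ.- p) p<q)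

0<-⇒< : ∀ {p q} → 0ℚ ℚ.< q ℚ.- p → p ℚ.< q
0<-⇒< {p} {q} 0<q-p =
  subst₂ ℚ._<_ (ℚ.+-identityˡ p) (solve 2 (λ p q → q :- p :+ p := q) refl p q) (ℚ.+-monoˡ-< p 0<q-p)
  where open +-*-Solver

<-by-difference : ∀ {p q r s} → q ℚ.- p ≡ s ℚ.- r → r ℚ.< s → p ℚ.< q
<-by-difference eq r<s = 0<-⇒< (subst (0ℚ ℚ.<_) (sym eq) (<⇒0<- r<s))

0<-halve : ∀ {p} → 0ℚ ℚ.< p ℚ.+ p → 0ℚ ℚ.< p
0<-halve {p} 0<2p =
  subst (0ℚ ℚ.<_) (solve 1 (λ p → con ½ :* (p :+ p) := p) refl p) (0<* (ℚ.positive⁻¹ ½) 0<2p)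
  where
  open +-*-Solver
  ½ = + 1 ℚ./ 2

-- ℚ(φ) as a commutative ring

-- (p + qφ)(r + sφ) expanded with φ² = φ + 1.
infixl 7 _⊗_
_⊗_ : ℚφ → ℚφ → ℚφ
(p + q φ) ⊗ (r + s φ) = (p ℚ.* r ℚ.+ q ℚ.* s) + (p ℚ.* s ℚ.+ q ℚ.* r ℚ.+ q ℚ.* s) φ

module _ where
  open +-*-Solver

  ⊗-assoc : ∀ x y z → (x ⊗ y) ⊗ z ≡ x ⊗ (y ⊗ z)
  ⊗-assoc (p + q φ) (r + s φ) (t + u φ) = cong₂ _+_φ
    (solve 6 (λ p q r s t u → (p :* r :+ q :* s) :* t :+ (p :* s :+ q :* r :+ q :* s) :* u
                          := p :* (r :* t :+ s :* u) :+ q :* (r :* u :+ s :* t :+ s :* u)) refl p q r s t u)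
    (solve 6 (λ p q r s t u → (p :* r :+ q :* s) :* u :+ (p :* s :+ q :* r :+ q :* s) :* t
                                :+ (p :* s :+ q :* r :+ q :* s) :* u
                          := p :* (r :* u :+ s :* t :+ s :* u) :+ q :* (r :* t :+ s :* u)
                                :+ q :* (r :* u :+ s :* t :+ s :* u)) refl p q r s t u)

  ⊗-comm : ∀ x y → x ⊗ y ≡ y ⊗ x
  ⊗-comm (p + q φ) (r + s φ) = cong₂ _+_φ
    (solve 4 (λ p q r s → p :* r :+ q :* s := r :* p :+ s :* q) refl p q r s)
    (solve 4 (λ p q r s → p :* s :+ q :* r :+ q :* s := r :* q :+ s :* p :+ s :* q) refl p q r s)

  ⊗-identityˡ : ∀ x → [ 1ℚ ] ⊗ x ≡ x
  ⊗-identityˡ (p + q φ) = cong₂ _+_φ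
    (solve 2 (λ p q → con 1ℚ :* p :+ con 0ℚ :* q := p) refl p q)
    (solve 2 (λ p q → con 1ℚ :* q :+ con 0ℚ :* p :+ con 0ℚ :* q := q) refl p q)

  ⊗-distribˡ-⊕ : ∀ x y z → x ⊗ (y ⊕ z) ≡ x ⊗ y ⊕ x ⊗ z
  ⊗-distribˡ-⊕ (p + q φ) (r + s φ) (t + u φ) = cong₂ _+_φ
    (solve 6 (λ p q r s t u → p :* (r :+ t) :+ q :* (s :+ u)
                          := (p :* r :+ q :* s) :+ (p :* t :+ q :* u)) refl p q r s t u)
    (solve 6 (λ p q r s t u → p :* (s :+ u) :+ q :* (r :+ t) :+ q :* (s :+ u)
                          := (p :* s :+ q :* r :+ q :* s) :+ (p :* u :+ q :* t :+ q :* u)) refl p q r s t u)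

  ·≡[]⊗ : ∀ r x → r · x ≡ [ r ] ⊗ x
  ·≡[]⊗ r (p + q φ) = cong₂ _+_φ
    (solve 3 (λ r p q → r :* p := r :* p :+ con 0ℚ :* q) refl r p q)
    (solve 3 (λ r p q → r :* q := r :* q :+ con 0ℚ :* p :+ con 0ℚ :* q) refl r p q)

  []-homo-* : ∀ p q → [ p ℚ.* q ] ≡ [ p ] ⊗ [ q ]
  []-homo-* p q = cong₂ _+_φ
    (solve 2 (λ p q → p :* q := p :* q :+ con 0ℚ :* con 0ℚ) refl p q)
    (solve 2 (λ p q → con 0ℚ := p :* con 0ℚ :+ con 0ℚ :* q :+ con 0ℚ :* con 0ℚ) refl p q)

  φ⁻¹⊗-coordinates : ∀ p q → φ⁻¹ ⊗ (p + q φ) ≡ (q ℚ.- p) + p φ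
  φ⁻¹⊗-coordinates p q = cong₂ _+_φ
    (solve 2 (λ p q → con (ℚ.- 1ℚ) :* p :+ con 1ℚ :* q := q :- p) refl p q)
    (solve 2 (λ p q → con (ℚ.- 1ℚ) :* q :+ con 1ℚ :* p :+ con 1ℚ :* q := p) refl p q)

⊕-assoc : ∀ x y z → (x ⊕ y) ⊕ z ≡ x ⊕ (y ⊕ z)
⊕-assoc (p + q φ) (r + s φ) (t + u φ) = cong₂ _+_φ (ℚ.+-assoc p r t) (ℚ.+-assoc q s u)

⊕-comm : ∀ x y → x ⊕ y ≡ y ⊕ x
⊕-comm (p + q φ) (r + s φ) = cong₂ _+_φ (ℚ.+-comm p r) (ℚ.+-comm q s)

⊕-identityˡ : ∀ x → [ 0ℚ ] ⊕ x ≡ x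
⊕-identityˡ (p + q φ) = cong₂ _+_φ (ℚ.+-identityˡ p) (ℚ.+-identityˡ q)

⊕-inverseˡ : ∀ x → (⊖ x) ⊕ x ≡ [ 0ℚ ]
⊕-inverseˡ (p + q φ) = cong₂ _+_φ (ℚ.+-inverseˡ p) (ℚ.+-inverseˡ q)

ℚφ-isCommutativeRing : IsCommutativeRing _⊕_ _⊗_ (⊖_) [ 0ℚ ] [ 1ℚ ]
ℚφ-isCommutativeRing = record
  { isRing = record
    { +-isAbelianGroup = record
      { isGroup = record
        { isMonoid = record
          { isSemigroup = record
            { isMagma = record { isEquivalence = isEquivalence ; ∙-cong = cong₂ _⊕_ }
            ; assoc = ⊕-assoc }
          ; identity = ⊕-identityˡ , comm∧idˡ⇒idʳ ⊕-comm ⊕-identityˡ }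
        ; inverse = ⊕-inverseˡ , λ x → trans (⊕-comm x (⊖ x)) (⊕-inverseˡ x)
        ; ⁻¹-cong = cong (⊖_) }
      ; comm = ⊕-comm }
    ; *-cong = cong₂ _⊗_
    ; *-assoc = ⊗-assoc
    ; *-identity = ⊗-identityˡ , comm∧idˡ⇒idʳ ⊗-comm ⊗-identityˡ
    ; distrib = ⊗-distribˡ-⊕ , comm∧distrˡ⇒distrʳ ⊗-comm ⊗-distribˡ-⊕ }
  ; *-comm = ⊗-comm }

ℚφ-commutativeRing : CommutativeRing 0ℓ 0ℓ
ℚφ-commutativeRing = record { isCommutativeRing = ℚφ-isCommutativeRing }

open CommutativeRing ℚφ-commutativeRing using (semiring)
open import Algebra.Definitions.RawSemiring (Semiring.rawSemiring semiring) public using (_^_)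
open import Algebra.Properties.Semiring.Exp semiring using (^-homo-*)

ℚφ-ring : ACR.AlmostCommutativeRing 0ℓ 0ℓ
ℚφ-ring = ACR.fromCommutativeRing ℚφ-commutativeRing 0≟
  where
  0≟ : ∀ x → Maybe ([ 0ℚ ] ≡ x)
  0≟ (p + q φ) with 0ℚ ℚ.≟ p | 0ℚ ℚ.≟ q
  ... | yes refl | yes refl = just refl
  ... | _        | _        = nothing

ψ : ℚφ
ψ = ⊖ φ⁻¹

-- Positivity in ℚ(φ)

CoordPos : ℚφ → Set
CoordPos (p + q φ) = 0ℚ ℚ.≤ p × 0ℚ ℚ.≤ q × (0ℚ ℚ.< p ⊎ 0ℚ ℚ.< q)

coordPos? : ∀ x → Dec (CoordPos x)
coordPos? (p + q φ) = (0ℚ ℚ.≤? p) ×-dec (0ℚ ℚ.≤? q) ×-dec ((0ℚ ℚ.<? p) ⊎-dec (0ℚ ℚ.<? q))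

CoordPos-⊕ : ∀ {x y} → CoordPos x → CoordPos y → CoordPos (x ⊕ y)
CoordPos-⊕ {p + q φ} {r + s φ} (0≤p , 0≤q , 0<p⊎0<q) (0≤r , 0≤s , _) with 0<p⊎0<q
... | inj₁ 0<p = 0≤+ 0≤p 0≤r , 0≤+ 0≤q 0≤s , inj₁ (0<+ˡ 0<p 0≤r)
... | inj₂ 0<q = 0≤+ 0≤p 0≤r , 0≤+ 0≤q 0≤s , inj₂ (0<+ˡ 0<q 0≤s)

CoordPos-⊗ : ∀ {x y} → CoordPos x → CoordPos y → CoordPos (x ⊗ y)
CoordPos-⊗ {p + q φ} {r + s φ} (0≤p , 0≤q , 0<p⊎0<q) (0≤r , 0≤s , 0<r⊎0<s) =
    0≤+ (0≤* 0≤p 0≤r) (0≤* 0≤q 0≤s)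
  , 0≤+ (0≤+ (0≤* 0≤p 0≤s) (0≤* 0≤q 0≤r)) (0≤* 0≤q 0≤s)
  , strict 0<p⊎0<q 0<r⊎0<s
  where
  strict : 0ℚ ℚ.< p ⊎ 0ℚ ℚ.< q → 0ℚ ℚ.< r ⊎ 0ℚ ℚ.< s →
           0ℚ ℚ.< p ℚ.* r ℚ.+ q ℚ.* s ⊎ 0ℚ ℚ.< p ℚ.* s ℚ.+ q ℚ.* r ℚ.+ q ℚ.* s
  strict (inj₁ 0<p) (inj₁ 0<r) = inj₁ (0<+ˡ (0<* 0<p 0<r) (0≤* 0≤q 0≤s))
  strict (inj₁ 0<p) (inj₂ 0<s) = inj₂ (0<+ˡ (0<+ˡ (0<* 0<p 0<s) (0≤* 0≤q 0≤r)) (0≤* 0≤q 0≤s))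
  strict (inj₂ 0<q) (inj₁ 0<r) = inj₂ (0<+ˡ (0<+ʳ (0≤* 0≤p 0≤s) (0<* 0<q 0<r)) (0≤* 0≤q 0≤s))
  strict (inj₂ 0<q) (inj₂ 0<s) = inj₂ (0<+ʳ (0≤+ (0≤* 0≤p 0≤s) (0≤* 0≤q 0≤r)) (0<* 0<q 0<s))

CoordPos-φ^ : ∀ k → CoordPos (φ ^ k)
CoordPos-φ^ zero    = from-yes (coordPos? [ 1ℚ ])
CoordPos-φ^ (suc k) = CoordPos-⊗ (from-yes (coordPos? φ)) (CoordPos-φ^ k)

CoordPos⇒Positive : ∀ {x} → CoordPos x → Positive x
CoordPos⇒Positive {p + q φ} (0≤p , 0≤q , inj₁ 0<p) =
  inj₁ (0≤+ (0≤+ 0≤p 0≤p) 0≤q , 0≤q , inj₁ (0<+ˡ (0<+ˡ 0<p 0≤p) 0≤q))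
CoordPos⇒Positive {p + q φ} (0≤p , 0≤q , inj₂ 0<q) =
  inj₁ (0≤+ (0≤+ 0≤p 0≤p) 0≤q , 0≤q , inj₂ 0<q)

module _ where
  open +-*-Solver

  private
    five four twenty : ℚ
    five   = + 5 ℚ./ 1
    four   = + 4 ℚ./ 1
    twenty = + 20 ℚ./ 1

    U U′ : ∀ {n} → Polynomial n → Polynomial n → Polynomial n
    U  p q = p :+ p :+ q
    U′ p q = (q :- p) :+ (q :- p) :+ p

    neg : ∀ {n} → Polynomial n → Polynomial n
    neg x = con 0ℚ :- x

    infix 10 _²
    _² : ∀ {n} → Polynomial n → Polynomial n
    x ² = x :* x

  -- In the coordinates u = 2p + q, v = q of Positive, dividing by φ maps (u, v) to
  -- ((5v - u)/2, (u - v)/2) and changes the sign of the norm u² - 5v².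
  Positive-÷φ-nonNeg : ∀ p q → 0ℚ ℚ.≤ (p ℚ.+ p) ℚ.+ q → 0ℚ ℚ.≤ q →
                       0ℚ ℚ.< (p ℚ.+ p) ℚ.+ q ⊎ 0ℚ ℚ.< q → Positive ((q ℚ.- p) + p φ)
  Positive-÷φ-nonNeg p q 0≤u 0≤q 0<u⊎0<q with ℚ.<-cmp p 0ℚ
  ... | tri< p<0 _ _ = inj₂ (inj₁ (0<u′ , p<0 , 5v′²<u′²))
    where
    0<-p = <⇒0<- p<0
    0<u′ = subst (0ℚ ℚ.<_) (solve 2 (λ p q → q :+ q :+ neg p := U′ p q) refl p q)
                 (0<+ʳ (0≤+ 0≤q 0≤q) 0<-p)
    5v′²<u′² = 0<-⇒< (subst (0ℚ ℚ.<_)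
      (solve 2 (λ p q → con four :* U p q ² :+ con twenty :* (U p q :* neg p) :+ con twenty :* neg p ²
                        := U′ p q ² :- con five :* p ²) refl p q)
      (0<+ʳ (0≤+ (0≤* (ℚ.nonNegative⁻¹ four) (0≤* 0≤u 0≤u))
                 (0≤* (ℚ.nonNegative⁻¹ twenty) (0≤* 0≤u (ℚ.<⇒≤ 0<-p))))
            (0<* (ℚ.positive⁻¹ twenty) (0<* 0<-p 0<-p))))
  ... | tri≈ _ refl _ = inj₁ (ℚ.<⇒≤ 0<u′ , ℚ.≤-refl , inj₁ 0<u′)
    where
    0<q : 0ℚ ℚ.< q
    0<q = Sum.[ subst (0ℚ ℚ.<_) (ℚ.+-identityˡ q) , (λ 0<q → 0<q) ] 0<u⊎0<q
    0<u′ : 0ℚ ℚ.< ((q ℚ.- 0ℚ) ℚ.+ (q ℚ.- 0ℚ)) ℚ.+ 0ℚ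
    0<u′ = subst (0ℚ ℚ.<_) (solve 1 (λ q → q :+ q := U′ (con 0ℚ) q) refl q) (0<+ˡ 0<q (ℚ.<⇒≤ 0<q))
  ... | tri> _ _ 0<p with 0ℚ ℚ.≤? ((q ℚ.- p) ℚ.+ (q ℚ.- p)) ℚ.+ p
  ...   | yes 0≤u′ = inj₁ (0≤u′ , ℚ.<⇒≤ 0<p , inj₂ 0<p)
  ...   | no  0≰u′ = inj₂ (inj₂ (u′<0 , 0<p , u′²<5v′²))
    where
    u′<0 = ℚ.≰⇒> 0≰u′
    0<-u′ = <⇒0<- u′<0
    u′²<5v′² = 0<-⇒< (subst (0ℚ ℚ.<_)
      (solve 2 (λ p q → con four :* neg (U′ p q) ² :+ (con twenty :* q ² :+ con twenty :* (q :* neg (U′ p q)))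
                        := con five :* p ² :- U′ p q ²) refl p q)
      (0<+ˡ (0<* (ℚ.positive⁻¹ four) (0<* 0<-u′ 0<-u′))
            (0≤+ (0≤* (ℚ.nonNegative⁻¹ twenty) (0≤* 0≤q 0≤q))
                 (0≤* (ℚ.nonNegative⁻¹ twenty) (0≤* 0≤q (ℚ.<⇒≤ 0<-u′))))))

  Positive-÷φ : ∀ p q → Positive (p + q φ) → Positive ((q ℚ.- p) + p φ)
  Positive-÷φ p q (inj₁ (0≤u , 0≤q , 0<u⊎0<q)) = Positive-÷φ-nonNeg p q 0≤u 0≤q 0<u⊎0<q
  Positive-÷φ p q (inj₂ (inj₁ (0<u , q<0 , 5v²<u²))) = inj₂ (inj₂ (u′<0 , 0<p , u′²<5v′²))
    where
    0<-q = <⇒0<- q<0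
    0<p = 0<-halve (subst (0ℚ ℚ.<_) (solve 2 (λ p q → U p q :+ neg q := p :+ p) refl p q)
                                    (0<+ˡ 0<u (ℚ.<⇒≤ 0<-q)))
    u′<0 = 0<-⇒< (subst (0ℚ ℚ.<_) (solve 2 (λ p q → p :+ neg q :+ neg q := neg (U′ p q)) refl p q)
                                 (0<+ˡ (0<+ˡ 0<p (ℚ.<⇒≤ 0<-q)) (ℚ.<⇒≤ 0<-q)))
    u′²<5v′² = <-by-difference
      (solve 2 (λ p q → con five :* p ² :- U′ p q ² := U p q ² :- con five :* q ²) refl p q) 5v²<u²
  Positive-÷φ p q (inj₂ (inj₂ (u<0 , 0<q , u²<5v²))) = inj₂ (inj₁ (0<u′ , p<0 , 5v′²<u′²))
    where
    0<-u = <⇒0<- u<0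
    0<-p = 0<-halve (subst (0ℚ ℚ.<_) (solve 2 (λ p q → neg (U p q) :+ q := neg p :+ neg p) refl p q)
                                     (0<+ˡ 0<-u (ℚ.<⇒≤ 0<q)))
    p<0 = 0<-⇒< 0<-p
    0<u′ = subst (0ℚ ℚ.<_) (solve 2 (λ p q → q :+ q :+ neg p := U′ p q) refl p q)
                 (0<+ʳ (0≤+ (ℚ.<⇒≤ 0<q) (ℚ.<⇒≤ 0<q)) 0<-p)
    5v′²<u′² = <-by-difference
      (solve 2 (λ p q → U′ p q ² :- con five :* p ² := con five :* q ² :- U p q ²) refl p q) u²<5v²

Positive-φ⁻¹⊗ : ∀ {x} → Positive x → Positive (φ⁻¹ ⊗ x)
Positive-φ⁻¹⊗ {p + q φ} pos = subst Positive (sym (φ⁻¹⊗-coordinates p q)) (Positive-÷φ p q pos)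

-- A sufficient condition for positivity which, unlike Positive, is visibly closed
-- under addition and multiplication.
Pos : ℚφ → Set
Pos x = ∃[ k ] CoordPos (φ ^ k ⊗ x)

CoordPos⇒Pos : ∀ {x} → CoordPos x → Pos x
CoordPos⇒Pos {x} h = 0 , subst CoordPos (sym (⊗-identityˡ x)) h

Pos-by-evaluation : ∀ k x → {True (coordPos? (φ ^ k ⊗ x))} → Pos x
Pos-by-evaluation k x {h} = k , toWitness h

Pos-⊕ : ∀ {x y} → Pos x → Pos y → Pos (x ⊕ y)
Pos-⊕ {x} {y} (k , hx) (j , hy) =
  k ℕ.+ j , subst CoordPos (sym shift)
                  (CoordPos-⊕ (CoordPos-⊗ (CoordPos-φ^ j) hx) (CoordPos-⊗ (CoordPos-φ^ k) hy))
  where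
  regroup : ∀ a b x y → (a ⊗ b) ⊗ (x ⊕ y) ≡ b ⊗ (a ⊗ x) ⊕ a ⊗ (b ⊗ y)
  regroup = solve-∀ ℚφ-ring
  shift : φ ^ (k ℕ.+ j) ⊗ (x ⊕ y) ≡ φ ^ j ⊗ (φ ^ k ⊗ x) ⊕ φ ^ k ⊗ (φ ^ j ⊗ y)
  shift = trans (cong (_⊗ (x ⊕ y)) (^-homo-* φ k j)) (regroup (φ ^ k) (φ ^ j) x y)

Pos-⊗ : ∀ {x y} → Pos x → Pos y → Pos (x ⊗ y)
Pos-⊗ {x} {y} (k , hx) (j , hy) = k ℕ.+ j , subst CoordPos (sym shift) (CoordPos-⊗ hx hy)
  where
  regroup : ∀ a b x y → (a ⊗ b) ⊗ (x ⊗ y) ≡ (a ⊗ x) ⊗ (b ⊗ y)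
  regroup = solve-∀ ℚφ-ring
  shift : φ ^ (k ℕ.+ j) ⊗ (x ⊗ y) ≡ (φ ^ k ⊗ x) ⊗ (φ ^ j ⊗ y)
  shift = trans (cong (_⊗ (x ⊗ y)) (^-homo-* φ k j)) (regroup (φ ^ k) (φ ^ j) x y)

Pos⇒Positive : ∀ {x} → Pos x → Positive x
Pos⇒Positive {x} (k , h) = go k x h
  where
  shift : ∀ a x → (φ ⊗ a) ⊗ x ≡ a ⊗ (φ ⊗ x)
  shift = solve-∀ ℚφ-ring
  cancel : ∀ x → φ⁻¹ ⊗ (φ ⊗ x) ≡ x
  cancel = solve-∀ ℚφ-ring
  go : ∀ k x → CoordPos (φ ^ k ⊗ x) → Positive x
  go zero    x h = CoordPos⇒Positive (subst CoordPos (⊗-identityˡ x) h)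
  go (suc k) x h =
    subst Positive (cancel x) (Positive-φ⁻¹⊗ {φ ⊗ x} (go k (φ ⊗ x) (subst CoordPos (shift (φ ^ k) x) h)))

Pos-[] : ∀ {r} → 0ℚ ℚ.< r → Pos [ r ]
Pos-[] 0<r = CoordPos⇒Pos (ℚ.<⇒≤ 0<r , ℚ.≤-refl , inj₁ 0<r)

infix 4 _<ᴾ_
record _<ᴾ_ (x y : ℚφ) : Set where
  constructor pos-diff
  field Pos-diff : Pos (y ⊖ x)

Between : ℚφ → ℚφ → ℚφ → Set
Between l x u = l <ᴾ x × x <ᴾ u

<ᴾ⇒<φ : ∀ {x y} → x <ᴾ y → x <φ y
<ᴾ⇒<φ (pos-diff h) = Pos⇒Positive h

<ᴾ-trans : ∀ {x y z} → x <ᴾ y → y <ᴾ z → x <ᴾ z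
<ᴾ-trans {x} {y} {z} (pos-diff x<y) (pos-diff y<z) = pos-diff (subst Pos (telescope x y z) (Pos-⊕ y<z x<y))
  where
  telescope : ∀ x y z → (z ⊖ y) ⊕ (y ⊖ x) ≡ z ⊖ x
  telescope = solve-∀ ℚφ-ring

⊕-monoʳ-<ᴾ : ∀ z {x y} → x <ᴾ y → z ⊕ x <ᴾ z ⊕ y
⊕-monoʳ-<ᴾ z {x} {y} (pos-diff x<y) = pos-diff (subst Pos (cancel z x y) x<y)
  where
  cancel : ∀ z x y → y ⊖ x ≡ (z ⊕ y) ⊖ (z ⊕ x)
  cancel = solve-∀ ℚφ-ring

⊗-monoʳ-<ᴾ : ∀ {z x y} → Pos z → x <ᴾ y → z ⊗ x <ᴾ z ⊗ y
⊗-monoʳ-<ᴾ {z} {x} {y} 0<z (pos-diff x<y) = pos-diff (subst Pos (distrib z x y) (Pos-⊗ 0<z x<y))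
  where
  distrib : ∀ z x y → z ⊗ (y ⊖ x) ≡ z ⊗ y ⊖ z ⊗ x
  distrib = solve-∀ ℚφ-ring

⊗-antitoneʳ-<ᴾ : ∀ {z x y} → Pos z → x <ᴾ y → ⊖ z ⊗ y <ᴾ ⊖ z ⊗ x
⊗-antitoneʳ-<ᴾ {z} {x} {y} 0<z (pos-diff x<y) = pos-diff (subst Pos (distrib z x y) (Pos-⊗ 0<z x<y))
  where
  distrib : ∀ z x y → z ⊗ (y ⊖ x) ≡ ⊖ z ⊗ x ⊖ ⊖ z ⊗ y
  distrib = solve-∀ ℚφ-ring

⊖-antitone-<ᴾ : ∀ {x y} → x <ᴾ y → ⊖ y <ᴾ ⊖ x
⊖-antitone-<ᴾ {x} {y} (pos-diff x<y) = pos-diff (subst Pos (negate x y) x<y)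
  where
  negate : ∀ x y → y ⊖ x ≡ ⊖ x ⊖ ⊖ y
  negate = solve-∀ ℚφ-ring

[]-mono-<ᴾ : ∀ {p q} → p ℚ.< q → [ p ] <ᴾ [ q ]
[]-mono-<ᴾ p<q = pos-diff (CoordPos⇒Pos (ℚ.<⇒≤ (<⇒0<- p<q) , ℚ.≤-refl , inj₁ (<⇒0<- p<q)))

Between-widen : ∀ {l l′ u u′ x} → l′ <ᴾ l → u <ᴾ u′ → Between l x u → Between l′ x u′
Between-widen l′<l u<u′ (l<x , x<u) = <ᴾ-trans l′<l l<x , <ᴾ-trans x<u u<u′

Between-⊗ : ∀ {z l x u} → Pos z → Between l x u → Between (z ⊗ l) (z ⊗ x) (z ⊗ u)
Between-⊗ 0<z (l<x , x<u) = ⊗-monoʳ-<ᴾ 0<z l<x , ⊗-monoʳ-<ᴾ 0<z x<u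

Between-scale : ∀ {r x} → 0ℚ ℚ.< r → Between (⊖ [ 1ℚ ]) x [ 1ℚ ] → Between (⊖ [ r ]) ([ r ] ⊗ x) [ r ]
Between-scale {r} {x} 0<r bounds =
  subst₂ (λ l u → Between l ([ r ] ⊗ x) u) (neg-unit [ r ]) (unit [ r ]) (Between-⊗ (Pos-[] 0<r) bounds)
  where
  neg-unit : ∀ z → z ⊗ ⊖ [ 1ℚ ] ≡ ⊖ z
  neg-unit = solve-∀ ℚφ-ring
  unit : ∀ z → z ⊗ [ 1ℚ ] ≡ z
  unit = solve-∀ ℚφ-ring

Pos-φ⁻¹ : Pos φ⁻¹
Pos-φ⁻¹ = Pos-by-evaluation 1 φ⁻¹

-1<ᴾ0 : ⊖ [ 1ℚ ] <ᴾ [ 0ℚ ]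
-1<ᴾ0 = pos-diff (Pos-by-evaluation 0 _)

0<ᴾφ : [ 0ℚ ] <ᴾ φ
0<ᴾφ = pos-diff (Pos-by-evaluation 0 _)

φ⁻¹<ᴾφ : φ⁻¹ <ᴾ φ
φ⁻¹<ᴾφ = pos-diff (Pos-by-evaluation 0 _)

φ⁻¹<ᴾ1 : φ⁻¹ <ᴾ [ 1ℚ ]
φ⁻¹<ᴾ1 = pos-diff (Pos-by-evaluation 2 _)

-1<ᴾ-φ⁻² : ⊖ [ 1ℚ ] <ᴾ ⊖ (φ⁻¹ ⊗ φ⁻¹)
-1<ᴾ-φ⁻² = pos-diff (Pos-by-evaluation 1 _)

ψ⊗-bounds : ∀ {x} → Between (⊖ [ 1ℚ ]) x φ → Between (⊖ [ 1ℚ ]) (ψ ⊗ x) φ⁻¹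
ψ⊗-bounds (-1<x , x<φ) = ⊗-antitoneʳ-<ᴾ Pos-φ⁻¹ x<φ , ⊗-antitoneʳ-<ᴾ Pos-φ⁻¹ -1<x

-- Conservation of the golden weight

bit : Bool → ℚφ
bit true  = [ 1ℚ ]
bit false = [ 0ℚ ]

flipDelta : Bool → ℚφ
flipDelta b = bit (not b) ⊖ bit b

-- An Inbound arrow at site j + 1 has weight ψ ^ j.
inboundWeight : ℕ → Arrows → ℚφ
inboundWeight zero    c = [ 0ℚ ]
inboundWeight (suc m) c = bit (c 1) ⊕ ψ ⊗ inboundWeight m (c ∘ suc)

inboundWeight-cong : ∀ m {c d} → (∀ j → c (suc j) ≡ d (suc j)) → inboundWeight m c ≡ inboundWeight m d
inboundWeight-cong zero    c≗d = refl
inboundWeight-cong (suc m) c≗d = cong₂ (λ b w → bit b ⊕ ψ ⊗ w) (c≗d 0) (inboundWeight-cong m (c≗d ∘ suc))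

inboundWeight-initial : ∀ m → inboundWeight m initial ≡ [ 0ℚ ]
inboundWeight-initial zero    = refl
inboundWeight-initial (suc m) = cong (λ w → bit false ⊕ ψ ⊗ w) (inboundWeight-initial m)

flipAt-suc : ∀ c i j → flipAt c (suc i) (suc j) ≡ flipAt (c ∘ suc) i j
flipAt-suc c i j with i ℕ.≡ᵇ j
... | true  = refl
... | false = refl

inboundWeight-flipAt : ∀ m c j → j < m →
  inboundWeight m (flipAt c (suc j)) ≡ inboundWeight m c ⊕ flipDelta (c (suc j)) ⊗ ψ ^ j
inboundWeight-flipAt (suc m) c zero _ =
  trans (cong (λ w → bit (not (c 1)) ⊕ ψ ⊗ w) (inboundWeight-cong m (λ _ → refl)))
        (exchange (bit (c 1)) (bit (not (c 1))) (inboundWeight m (c ∘ suc)))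
  where
  exchange : ∀ b b′ w → b′ ⊕ ψ ⊗ w ≡ (b ⊕ ψ ⊗ w) ⊕ (b′ ⊖ b) ⊗ [ 1ℚ ]
  exchange = solve-∀ ℚφ-ring
inboundWeight-flipAt (suc m) c (suc j) (s≤s j<m) = begin
  bit (c 1) ⊕ ψ ⊗ inboundWeight m (flipAt c (suc (suc j)) ∘ suc)
    ≡⟨ cong (λ w → bit (c 1) ⊕ ψ ⊗ w) (inboundWeight-cong m (λ i → flipAt-suc c (suc j) (suc i))) ⟩
  bit (c 1) ⊕ ψ ⊗ inboundWeight m (flipAt (c ∘ suc) (suc j))
    ≡⟨ cong (λ w → bit (c 1) ⊕ ψ ⊗ w) (inboundWeight-flipAt m (c ∘ suc) j j<m) ⟩
  bit (c 1) ⊕ ψ ⊗ (inboundWeight m (c ∘ suc) ⊕ δ ⊗ ψ ^ j)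
    ≡⟨ shift (bit (c 1)) (inboundWeight m (c ∘ suc)) δ (ψ ^ j) ⟩
  (bit (c 1) ⊕ ψ ⊗ inboundWeight m (c ∘ suc)) ⊕ δ ⊗ ψ ^ suc j ∎
  where
  open ≡-Reasoning
  δ = flipDelta (c (suc (suc j)))
  shift : ∀ b w δ x → b ⊕ ψ ⊗ (w ⊕ δ ⊗ x) ≡ (b ⊕ ψ ⊗ w) ⊕ δ ⊗ (ψ ⊗ x)
  shift = solve-∀ ℚφ-ring

-- The weight of site -1 is ψ ^ -1 = -φ; sites below -1 are never visited.
positionWeight : ℤ → ℚφ
positionWeight (+ n)          = ψ ^ n
positionWeight -[1+ zero ]    = ⊖ φ
positionWeight -[1+ suc _ ]   = [ 0ℚ ]

cupSite : Cup → ℤ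
cupSite cup0    = + 0
cupSite cupNeg1 = -[1+ 0 ]

energy : ℕ → ℤ → Arrows → ℚφ
energy m p c = positionWeight p ⊕ inboundWeight m c

-- Both identities amount to ψ² = ψ + 1.
inward-hop : ∀ k → ψ ^ suc k ≡ positionWeight (+ suc k ℤ.- + 2) ⊕ flipDelta false ⊗ ψ ^ k
inward-hop zero          = refl
inward-hop (suc zero)    = refl
inward-hop (suc (suc k)) = ψ³ (ψ ^ k)
  where
  ψ³ : ∀ x → ψ ⊗ (ψ ⊗ (ψ ⊗ x)) ≡ ψ ⊗ x ⊕ flipDelta false ⊗ (ψ ⊗ (ψ ⊗ x))
  ψ³ = solve-∀ ℚφ-ring

outward-hop : ∀ k → ψ ^ suc k ≡ positionWeight (+ suc (suc k)) ⊕ flipDelta true ⊗ ψ ^ k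
outward-hop k = ψ² (ψ ^ k)
  where
  ψ² : ∀ x → ψ ⊗ x ≡ ψ ⊗ (ψ ⊗ x) ⊕ flipDelta true ⊗ x
  ψ² = solve-∀ ℚφ-ring

hop-conserves-energy : ∀ {m k b} p p′ c → c (suc k) ≡ b → k < m →
  positionWeight p ≡ positionWeight p′ ⊕ flipDelta b ⊗ ψ ^ k →
  energy m p c ≡ energy m p′ (flipAt c (suc k))
hop-conserves-energy {m} {k} p p′ c refl k<m weights = begin
  positionWeight p ⊕ inboundWeight m c
    ≡⟨ cong (_⊕ inboundWeight m c) weights ⟩
  (positionWeight p′ ⊕ flipDelta (c (suc k)) ⊗ ψ ^ k) ⊕ inboundWeight m c
    ≡⟨ regroup (positionWeight p′) (flipDelta (c (suc k)) ⊗ ψ ^ k) (inboundWeight m c) ⟩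
  positionWeight p′ ⊕ (inboundWeight m c ⊕ flipDelta (c (suc k)) ⊗ ψ ^ k)
    ≡⟨ cong (positionWeight p′ ⊕_) (sym (inboundWeight-flipAt m c k k<m)) ⟩
  positionWeight p′ ⊕ inboundWeight m (flipAt c (suc k)) ∎
  where
  open ≡-Reasoning
  regroup : ∀ x y z → (x ⊕ y) ⊕ z ≡ x ⊕ (z ⊕ y)
  regroup = solve-∀ ℚφ-ring

Eventually : (ℕ → Set) → Set
Eventually P = ∃[ m₀ ] ∀ {m} → m₀ ≤ m → P m

eventually-> : ∀ k → Eventually (k <_)
eventually-> k = suc k , λ k<m → k<m

Eventually-zipWith : ∀ {P Q R : ℕ → Set} → (∀ {m} → P m → Q m → R m) →
                     Eventually P → Eventually Q → Eventually R
Eventually-zipWith f (m₁ , p) (m₂ , q) =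
  m₁ ⊔ m₂ , λ le → f (p (ℕ.m⊔n≤o⇒m≤o m₁ m₂ le)) (q (ℕ.m⊔n≤o⇒n≤o m₁ m₂ le))

-- inboundWeight m only sees sites 1, …, m, so energy is conserved once m exceeds every
-- site the bug visits.
walk-conserves-energy : ∀ {c p r d} → Walk c p r d →
  Eventually (λ m → energy m p c ≡ energy m (cupSite r) d)
walk-conserves-energy stop0    = 0 , λ _ → refl
walk-conserves-energy stopNeg1 = 0 , λ _ → refl
walk-conserves-energy {c} (hopIn {k = k} out w) =
  Eventually-zipWith
    (λ {m} k<m → trans (hop-conserves-energy {m} (+ suc k) (+ suc k ℤ.- + 2) c out k<m (inward-hop k)))
    (eventually-> k) (walk-conserves-energy w)
walk-conserves-energy {c} (hopOut {k = k} in′ w) =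
  Eventually-zipWith
    (λ {m} k<m → trans (hop-conserves-energy {m} (+ suc k) (+ suc (suc k)) c in′ k<m (outward-hop k)))
    (eventually-> k) (walk-conserves-energy w)

imbalance : ℕ → ℕ → ℚφ
imbalance a b = [ ℕ→ℚ a ] ⊖ [ ℕ→ℚ b ] ⊗ φ

toℚᵘ-/ : ∀ i d → ℚ.toℚᵘ (i ℚ./ suc d) ℚᵘ.≃ mkℚᵘ i d
toℚᵘ-/ i d = ℚ.toℚᵘ-fromℚᵘ (mkℚᵘ i d)

ℕ→ℚ-homo-+ : ∀ m n → ℕ→ℚ (m ℕ.+ n) ≡ ℕ→ℚ m ℚ.+ ℕ→ℚ n
ℕ→ℚ-homo-+ m n = ℚ.toℚᵘ-injective (begin
  ℚ.toℚᵘ (ℕ→ℚ (m ℕ.+ n))               ≈⟨ toℚᵘ-/ (+ (m ℕ.+ n)) 0 ⟩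
  mkℚᵘ (+ (m ℕ.+ n)) 0                  ≈⟨ *≡* (cross-multiplied (+ m) (+ n)) ⟩
  mkℚᵘ (+ m) 0 ℚᵘ.+ mkℚᵘ (+ n) 0        ≈⟨ ℚᵘ.+-cong (toℚᵘ-/ (+ m) 0) (toℚᵘ-/ (+ n) 0) ⟨
  ℚ.toℚᵘ (ℕ→ℚ m) ℚᵘ.+ ℚ.toℚᵘ (ℕ→ℚ n)   ≈⟨ ℚ.toℚᵘ-homo-+ (ℕ→ℚ m) (ℕ→ℚ n) ⟨
  ℚ.toℚᵘ (ℕ→ℚ m ℚ.+ ℕ→ℚ n)             ∎)
  where
  open ℚᵘ.≃-Reasoning
  cross-multiplied : ∀ x y → (x ℤ.+ y) ℤ.* + 1 ≡ (x ℤ.* + 1 ℤ.+ y ℤ.* + 1) ℤ.* + 1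
  cross-multiplied = ℤ-Solver.solve-∀

/-as-* : ∀ i d → + i ℚ./ suc d ≡ ℕ→ℚ i ℚ.* (+ 1 ℚ./ suc d)
/-as-* i d = ℚ.toℚᵘ-injective (begin
  ℚ.toℚᵘ (+ i ℚ./ suc d)                              ≈⟨ toℚᵘ-/ (+ i) d ⟩
  mkℚᵘ (+ i) d                                         ≈⟨ *≡* (cross-multiplied (+ i) (+ suc d)) ⟨
  mkℚᵘ (+ i) 0 ℚᵘ.* mkℚᵘ (+ 1) d                       ≈⟨ ℚᵘ.*-cong (toℚᵘ-/ (+ i) 0) (toℚᵘ-/ (+ 1) d) ⟨
  ℚ.toℚᵘ (ℕ→ℚ i) ℚᵘ.* ℚ.toℚᵘ (+ 1 ℚ./ suc d)          ≈⟨ ℚ.toℚᵘ-homo-* (ℕ→ℚ i) (+ 1 ℚ./ suc d) ⟨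
  ℚ.toℚᵘ (ℕ→ℚ i ℚ.* (+ 1 ℚ./ suc d))                  ∎)
  where
  open ℚᵘ.≃-Reasoning
  cross-multiplied : ∀ x y → (x ℤ.* + 1) ℤ.* y ≡ x ℤ.* (+ 1 ℤ.* y)
  cross-multiplied = ℤ-Solver.solve-∀

ℕ→ℚ-*-inverse : ∀ d → ℕ→ℚ (suc d) ℚ.* (+ 1 ℚ./ suc d) ≡ 1ℚ
ℕ→ℚ-*-inverse d = ℚ.toℚᵘ-injective (begin
  ℚ.toℚᵘ (ℕ→ℚ (suc d) ℚ.* (+ 1 ℚ./ suc d))
    ≈⟨ ℚ.toℚᵘ-homo-* (ℕ→ℚ (suc d)) (+ 1 ℚ./ suc d) ⟩
  ℚ.toℚᵘ (ℕ→ℚ (suc d)) ℚᵘ.* ℚ.toℚᵘ (+ 1 ℚ./ suc d)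
    ≈⟨ ℚᵘ.*-cong (toℚᵘ-/ (+ suc d) 0) (toℚᵘ-/ (+ 1) d) ⟩
  mkℚᵘ (+ suc d) 0 ℚᵘ.* mkℚᵘ (+ 1) d
    ≈⟨ *≡* (trans (cross-multiplied (+ suc d)) (cong (λ k → + 1 ℤ.* + suc k) (sym (ℕ.+-identityʳ d)))) ⟩
  mkℚᵘ (+ 1) 0 ∎)
  where
  open ℚᵘ.≃-Reasoning
  cross-multiplied : ∀ x → (x ℤ.* + 1) ℤ.* + 1 ≡ + 1 ℤ.* x
  cross-multiplied = ℤ-Solver.solve-∀

1/suc<ε : ∀ ε → 0ℚ ℚ.< ε → ∃[ N ] ∀ {n} → N ≤ n → + 1 ℚ./ suc n ℚ.< ε
1/suc<ε (ℚ.mkℚ (+ suc k) d _) _ = suc d , λ {n} d<n →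
  ℚ.toℚᵘ-cancel-< (ℚᵘ.<-respˡ-≃ (ℚᵘ.≃-sym (toℚᵘ-/ (+ 1) n)) (ℚᵘ.*<* (cross-multiplied d<n)))
  where
  cross-multiplied : ∀ {n} → suc d ≤ n → + 1 ℤ.* + suc d ℤ.< + suc k ℤ.* + suc n
  cross-multiplied {n} d<n = subst₂ ℤ._<_ (ℤ.pos-* 1 (suc d)) (ℤ.pos-* (suc k) (suc n))
    (ℤ.+<+ (subst (ℕ._< suc k ℕ.* suc n) (sym (ℕ.*-identityˡ (suc d)))
      (ℕ.≤-<-trans d<n (ℕ.<-≤-trans (ℕ.n<1+n n) (ℕ.m≤n*m (suc n) (suc k))))))
1/suc<ε (ℚ.mkℚ (+ zero)   d _) (ℚ.*<* (ℤ.+<+ ()))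
1/suc<ε (ℚ.mkℚ -[1+ k ]   d _) (ℚ.*<* ())

imbalance-sucˡ : ∀ a b → [ 1ℚ ] ⊕ imbalance a b ≡ imbalance (suc a) b
imbalance-sucˡ a b =
  trans (shift [ ℕ→ℚ a ] [ ℕ→ℚ b ]) (cong (λ x → [ x ] ⊖ [ ℕ→ℚ b ] ⊗ φ) (sym (ℕ→ℚ-homo-+ 1 a)))
  where
  shift : ∀ x y → [ 1ℚ ] ⊕ (x ⊖ y ⊗ φ) ≡ ([ 1ℚ ] ⊕ x) ⊖ y ⊗ φ
  shift = solve-∀ ℚφ-ring

imbalance-sucʳ : ∀ a b → ⊖ φ ⊕ imbalance a b ≡ imbalance a (suc b)
imbalance-sucʳ a b =
  trans (shift [ ℕ→ℚ a ] [ ℕ→ℚ b ]) (cong (λ y → [ ℕ→ℚ a ] ⊖ [ y ] ⊗ φ) (sym (ℕ→ℚ-homo-+ 1 b)))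
  where
  shift : ∀ x y → ⊖ φ ⊕ (x ⊖ y ⊗ φ) ≡ x ⊖ ([ 1ℚ ] ⊕ y) ⊗ φ
  shift = solve-∀ ℚφ-ring

landing-shift : ∀ {w v t w′} → w ≡ v → ψ ⊕ w ≡ t ⊕ w′ → w′ ≡ (ψ ⊖ t) ⊕ v
landing-shift {w} {v} {t} {w′} refl e = begin
  w′             ≡⟨ cancel t w′ ⟩
  (t ⊕ w′) ⊖ t   ≡⟨ cong (_⊖ t) e ⟨
  (ψ ⊕ w) ⊖ t    ≡⟨ regroup w t ⟩
  (ψ ⊖ t) ⊕ w    ∎
  where
  open ≡-Reasoning
  cancel : ∀ t w → w ≡ (t ⊕ w) ⊖ t
  cancel = solve-∀ ℚφ-ring
  regroup : ∀ w t → (ψ ⊕ w) ⊖ t ≡ (ψ ⊖ t) ⊕ w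
  regroup = solve-∀ ℚφ-ring

run-inboundWeight : ∀ {n a b c} → Run n a b c → Eventually (λ m → inboundWeight m c ≡ imbalance a b)
run-inboundWeight start = 0 , λ {m} _ → inboundWeight-initial m
run-inboundWeight (landNeg1 {a = a} {b} run w) =
  Eventually-zipWith (λ v e → trans (landing-shift {t = ⊖ φ} v e) (imbalance-sucˡ a b))
                     (run-inboundWeight run) (walk-conserves-energy w)
run-inboundWeight (land0 {a = a} {b} run w) =
  Eventually-zipWith (λ v e → trans (landing-shift {t = [ 1ℚ ]} v e) (imbalance-sucʳ a b))
                     (run-inboundWeight run) (walk-conserves-energy w)

bit⊕-bounds : ∀ b {y} → Between (⊖ [ 1ℚ ]) y φ⁻¹ → Between (⊖ [ 1ℚ ]) (bit b ⊕ y) φ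
bit⊕-bounds false (-1<y , y<φ⁻¹) = ⊕-monoʳ-<ᴾ [ 0ℚ ] -1<y , <ᴾ-trans (⊕-monoʳ-<ᴾ [ 0ℚ ] y<φ⁻¹) φ⁻¹<ᴾφ
bit⊕-bounds true  (-1<y , y<φ⁻¹) = <ᴾ-trans -1<ᴾ0 (⊕-monoʳ-<ᴾ [ 1ℚ ] -1<y) , ⊕-monoʳ-<ᴾ [ 1ℚ ] y<φ⁻¹

inboundWeight-bounds : ∀ m c → Between (⊖ [ 1ℚ ]) (inboundWeight m c) φ
inboundWeight-bounds zero    c = -1<ᴾ0 , 0<ᴾφ
inboundWeight-bounds (suc m) c = bit⊕-bounds (c 1) (ψ⊗-bounds (inboundWeight-bounds m (c ∘ suc)))

run-bounds : ∀ {n a b c} → Run n a b c → Between (⊖ [ 1ℚ ]) (imbalance a b) φ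
run-bounds {c = c} run with run-inboundWeight run
... | m₀ , weight≡ = subst (λ v → Between (⊖ [ 1ℚ ]) v φ) (weight≡ ℕ.≤-refl) (inboundWeight-bounds m₀ c)

run-count : ∀ {n a b c} → Run n a b c → n ≡ a ℕ.+ b
run-count start              = refl
run-count (landNeg1 run _)   = cong suc (run-count run)
run-count (land0 {a = a} {b} run _) = trans (cong suc (run-count run)) (sym (ℕ.+-suc a b))

-- Every bug lands in a cup

flipAt-same : ∀ c i → flipAt c i i ≡ not (c i)
flipAt-same c i with i ℕ.≡ᵇ i | ℕ.≡⇒≡ᵇ i i refl
... | true  | _  = refl
... | false | ()

flipAt-diff : ∀ c {i j} → i ≢ j → flipAt c i j ≡ c j
flipAt-diff c {i} {j} i≢j with i ℕ.≡ᵇ j | ℕ.≡ᵇ⇒≡ i j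
... | true  | i≡j = ⊥-elim (i≢j (i≡j _))
... | false | _   = refl

Lands : Arrows → ℤ → Set
Lands c p = ∃[ r ] ∃[ d ] Walk c p r d

OutboundUpTo : Arrows → ℕ → Set
OutboundUpTo c k = ∀ {i} → i < k → c (suc i) ≡ false

FinitelyInbound : Arrows → Set
FinitelyInbound c = ∃[ M ] ∀ {j} → M ≤ j → c (suc j) ≡ false

OutboundUpTo-suc : ∀ c {k} → OutboundUpTo c k → c (suc k) ≡ false → OutboundUpTo c (suc k)
OutboundUpTo-suc c out last i<1+k with ℕ.m≤n⇒m<n∨m≡n (ℕ.≤-pred i<1+k)
... | inj₁ i<k  = out i<k
... | inj₂ refl = last

OutboundUpTo-flipAt : ∀ c {k j} → k ≤ j → OutboundUpTo c k → OutboundUpTo (flipAt c (suc j)) k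
OutboundUpTo-flipAt c k≤j out i<k =
  trans (flipAt-diff c (≢-sym (ℕ.<⇒≢ (s≤s (ℕ.<-≤-trans i<k k≤j))))) (out i<k)

descend : ∀ k c → OutboundUpTo c k → Lands c (+ k)
descend zero          c out = cup0 , c , stop0
descend (suc zero)    c out = cupNeg1 , flipAt c 1 , hopIn (out (s≤s z≤n)) stopNeg1
descend (suc (suc k)) c out =
  map₂ (map₂ (hopIn (out ℕ.≤-refl)))
       (descend k (flipAt c (suc (suc k)))
                (OutboundUpTo-flipAt c (ℕ.n≤1+n k) (λ i<k → out (ℕ.m<n⇒m<1+n (ℕ.m<n⇒m<1+n i<k)))))

-- The first Outbound arrow at or above site k + 1 is at most t sites higher; the bug
-- climbs to it, turning the Inbound arrows it passes Outbound, and then descends.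
climb : ∀ t k c → OutboundUpTo c k → c (suc (t ℕ.+ k)) ≡ false → Lands c (+ suc k)
climb zero    k c out last = descend (suc k) c (OutboundUpTo-suc c out last)
climb (suc t) k c out last with c (suc k) in eq
... | false = descend (suc k) c (OutboundUpTo-suc c out eq)
... | true  = map₂ (map₂ (hopOut eq)) (climb t (suc k) (flipAt c (suc k)) out′ last′)
  where
  out′ : OutboundUpTo (flipAt c (suc k)) (suc k)
  out′ = OutboundUpTo-suc (flipAt c (suc k)) (OutboundUpTo-flipAt c ℕ.≤-refl out)
                          (trans (flipAt-same c (suc k)) (cong not eq))
  last′ : flipAt c (suc k) (suc (t ℕ.+ suc k)) ≡ false
  last′ = trans (flipAt-diff c (ℕ.<⇒≢ (s≤s (ℕ.m≤n+m (suc k) t))))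
                (subst (λ j → c (suc j) ≡ false) (sym (ℕ.+-suc t k)) last)

FinitelyInbound-flipAt : ∀ {c} k → FinitelyInbound c → FinitelyInbound (flipAt c (suc k))
FinitelyInbound-flipAt {c} k (M , out) = M ⊔ suc k , λ le →
  trans (flipAt-diff c (ℕ.<⇒≢ (s≤s (ℕ.m⊔n≤o⇒n≤o M (suc k) le)))) (out (ℕ.m⊔n≤o⇒m≤o M (suc k) le))

walk-preserves-FinitelyInbound : ∀ {c p r d} → Walk c p r d → FinitelyInbound c → FinitelyInbound d
walk-preserves-FinitelyInbound stop0                 = id
walk-preserves-FinitelyInbound stopNeg1              = id
walk-preserves-FinitelyInbound (hopIn  {k = k} _ w) = walk-preserves-FinitelyInbound w ∘ FinitelyInbound-flipAt k
walk-preserves-FinitelyInbound (hopOut {k = k} _ w) = walk-preserves-FinitelyInbound w ∘ FinitelyInbound-flipAt k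

lands-from-1 : ∀ {c} → FinitelyInbound c → Lands c (+ 1)
lands-from-1 {c} (M , out) = climb M 0 c (λ ()) (out (ℕ.m≤m+n M 0))

runs-exist : ∀ n → ∃[ a ] ∃[ b ] ∃[ c ] Run n a b c × FinitelyInbound c
runs-exist zero = 0 , 0 , initial , start , 0 , λ _ → refl
runs-exist (suc n) with runs-exist n
... | a , b , c , run , finite with lands-from-1 finite
...   | cupNeg1 , d , w = suc a , b , d , landNeg1 run w , walk-preserves-FinitelyInbound w finite
...   | cup0    , d , w = a , suc b , d , land0 run w , walk-preserves-FinitelyInbound w finite

ψ⊗imbalance : ∀ x y → ψ ⊗ (x ⊖ y ⊗ φ) ≡ y ⊖ x ⊗ φ⁻¹
ψ⊗imbalance = solve-∀ ℚφ-ring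

ratio-as-multiple : ∀ x s r → s ⊗ r ≡ [ 1ℚ ] → x ⊗ r ⊖ φ⁻¹ ≡ r ⊗ (x ⊖ s ⊗ φ⁻¹)
ratio-as-multiple x s r sr≡1 = begin
  x ⊗ r ⊖ φ⁻¹             ≡⟨ cong (λ t → x ⊗ r ⊖ t ⊗ φ⁻¹) sr≡1 ⟨
  x ⊗ r ⊖ (s ⊗ r) ⊗ φ⁻¹   ≡⟨ factor x s r ⟩
  r ⊗ (x ⊖ s ⊗ φ⁻¹)       ∎
  where
  open ≡-Reasoning
  factor : ∀ x s r → x ⊗ r ⊖ (s ⊗ r) ⊗ φ⁻¹ ≡ r ⊗ (x ⊖ s ⊗ φ⁻¹)
  factor = solve-∀ ℚφ-ring

[]-fraction : ∀ i d → [ + i ℚ./ suc d ] ≡ [ ℕ→ℚ i ] ⊗ [ + 1 ℚ./ suc d ]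
[]-fraction i d = trans (cong [_] (/-as-* i d)) ([]-homo-* (ℕ→ℚ i) (+ 1 ℚ./ suc d))

[]-*-inverse : ∀ d → [ ℕ→ℚ (suc d) ] ⊗ [ + 1 ℚ./ suc d ] ≡ [ 1ℚ ]
[]-*-inverse d = trans (sym ([]-homo-* (ℕ→ℚ (suc d)) (+ 1 ℚ./ suc d))) (cong [_] (ℕ→ℚ-*-inverse d))

0<1/suc : ∀ n → 0ℚ ℚ.< + 1 ℚ./ suc n
0<1/suc n = ℚ.positive⁻¹ _ {{ℚ.normalize-pos 1 (suc n)}}

Between⇒<φ : ∀ {l x u} → Between l x u → l <φ x × x <φ u
Between⇒<φ = map <ᴾ⇒<φ <ᴾ⇒<φ

deviation-bounds : ∀ {n a b c} → Run n a b c →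
  Between (⊖ [ 1ℚ ]) ([ ℕ→ℚ b ] ⊖ (ℕ→ℚ a · φ⁻¹)) φ⁻¹
deviation-bounds {a = a} {b} run =
  subst (λ v → Between (⊖ [ 1ℚ ]) v φ⁻¹) deviation≡ (ψ⊗-bounds (run-bounds run))
  where
  deviation≡ : ψ ⊗ imbalance a b ≡ [ ℕ→ℚ b ] ⊖ (ℕ→ℚ a · φ⁻¹)
  deviation≡ = trans (ψ⊗imbalance [ ℕ→ℚ a ] [ ℕ→ℚ b ])
                     (cong (λ t → [ ℕ→ℚ b ] ⊖ t) (sym (·≡[]⊗ (ℕ→ℚ a) φ⁻¹)))

ratio-bounds : ∀ {n a b c} → Run n (suc a) b c →
  Between (⊖ [ + 1 ℚ./ suc a ]) ([ + b ℚ./ suc a ] ⊖ φ⁻¹) [ + 1 ℚ./ suc a ]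
ratio-bounds {a = a} {b} run =
  subst (λ v → Between (⊖ [ r ]) v [ r ]) (sym ratio≡)
        (Between-scale (0<1/suc a) (map₂ (λ x<φ⁻¹ → <ᴾ-trans x<φ⁻¹ φ⁻¹<ᴾ1) (ψ⊗-bounds (run-bounds run))))
  where
  r = + 1 ℚ./ suc a
  ratio≡ : [ + b ℚ./ suc a ] ⊖ φ⁻¹ ≡ [ r ] ⊗ (ψ ⊗ imbalance (suc a) b)
  ratio≡ = begin
    [ + b ℚ./ suc a ] ⊖ φ⁻¹
      ≡⟨ cong (_⊖ φ⁻¹) ([]-fraction b a) ⟩
    [ ℕ→ℚ b ] ⊗ [ r ] ⊖ φ⁻¹
      ≡⟨ ratio-as-multiple [ ℕ→ℚ b ] [ ℕ→ℚ (suc a) ] [ r ] ([]-*-inverse a) ⟩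
    [ r ] ⊗ ([ ℕ→ℚ b ] ⊖ [ ℕ→ℚ (suc a) ] ⊗ φ⁻¹)
      ≡⟨ cong ([ r ] ⊗_) (ψ⊗imbalance [ ℕ→ℚ (suc a) ] [ ℕ→ℚ b ]) ⟨
    [ r ] ⊗ (ψ ⊗ imbalance (suc a) b) ∎
    where open ≡-Reasoning

frequency-bounds : ∀ {ε n a b c} → + 1 ℚ./ suc n ℚ.< ε → Run (suc n) a b c →
  Between (⊖ [ ε ]) ([ + a ℚ./ suc n ] ⊖ φ⁻¹) [ ε ]
frequency-bounds {ε} {n} {a} {b} r<ε run =
  subst (λ v → Between (⊖ [ ε ]) v [ ε ]) (sym frequency≡)
        (Between-widen (⊖-antitone-<ᴾ ([]-mono-<ᴾ r<ε)) ([]-mono-<ᴾ r<ε)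
          (Between-scale (0<1/suc n)
            (Between-widen -1<ᴾ-φ⁻² φ⁻¹<ᴾ1 (Between-⊗ (Pos-⊗ Pos-φ⁻¹ Pos-φ⁻¹) (run-bounds run)))))
  where
  r = + 1 ℚ./ suc n
  A = [ ℕ→ℚ a ]
  B = [ ℕ→ℚ b ]
  total⊗r≡1 : (A ⊕ B) ⊗ [ r ] ≡ [ 1ℚ ]
  total⊗r≡1 =
    trans (cong (λ k → [ k ] ⊗ [ r ]) (trans (sym (ℕ→ℚ-homo-+ a b)) (cong ℕ→ℚ (sym (run-count run)))))
          ([]-*-inverse n)
  regroup : ∀ x y → x ⊖ (x ⊕ y) ⊗ φ⁻¹ ≡ (φ⁻¹ ⊗ φ⁻¹) ⊗ (x ⊖ y ⊗ φ)
  regroup = solve-∀ ℚφ-ring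
  frequency≡ : [ + a ℚ./ suc n ] ⊖ φ⁻¹ ≡ [ r ] ⊗ ((φ⁻¹ ⊗ φ⁻¹) ⊗ imbalance a b)
  frequency≡ = begin
    [ + a ℚ./ suc n ] ⊖ φ⁻¹            ≡⟨ cong (_⊖ φ⁻¹) ([]-fraction a n) ⟩
    A ⊗ [ r ] ⊖ φ⁻¹                    ≡⟨ ratio-as-multiple A (A ⊕ B) [ r ] total⊗r≡1 ⟩
    [ r ] ⊗ (A ⊖ (A ⊕ B) ⊗ φ⁻¹)        ≡⟨ cong ([ r ] ⊗_) (regroup A B) ⟩
    [ r ] ⊗ ((φ⁻¹ ⊗ φ⁻¹) ⊗ imbalance a b) ∎
    where open ≡-Reasoning

mainTheorem2 :
  -- every bug lands in a cup: the process is defined for all n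
  (∀ n → ∃[ a ] ∃[ b ] ∃[ c ] Run n a b c)
  -- -1 < b_n - a_n/φ < 1/φ for all n ≥ 1
  × (∀ n a b c → Run (suc n) a b c →
       (⊖ [ 1ℚ ] <φ [ ℕ→ℚ b ] ⊖ (ℕ→ℚ a · φ⁻¹))
       × ([ ℕ→ℚ b ] ⊖ (ℕ→ℚ a · φ⁻¹) <φ φ⁻¹))
  -- whenever a_n > 0 : | b_n/a_n - 1/φ | < 1/a_n
  × (∀ n a b c → Run n (suc a) b c →
       (⊖ [ + 1 ℚ./ suc a ] <φ [ + b ℚ./ suc a ] ⊖ φ⁻¹)
       × ([ + b ℚ./ suc a ] ⊖ φ⁻¹ <φ [ + 1 ℚ./ suc a ]))
  -- a_n / n → 1/φ
  × (∀ (ε : ℚ) → 0ℚ ℚ.< ε → ∃[ N ] ∀ n a b c → N ≤ n → Run (suc n) a b c →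
       (⊖ [ ε ] <φ [ + a ℚ./ suc n ] ⊖ φ⁻¹)
       × ([ + a ℚ./ suc n ] ⊖ φ⁻¹ <φ [ ε ]))
mainTheorem2 =
    (λ n → let a , b , c , run , _ = runs-exist n in a , b , c , run)
  , (λ _ _ _ _ → Between⇒<φ ∘ deviation-bounds)
  , (λ _ _ _ _ → Between⇒<φ ∘ ratio-bounds)
  , λ ε 0<ε → let N , 1/suc<ε′ = 1/suc<ε ε 0<ε in
      N , λ _ _ _ _ N≤n → Between⇒<φ ∘ frequency-bounds (1/suc<ε′ N≤n)
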